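{- Let $G$ be a graph with PSD forcing set $B$ such that $G-B$ is connected. Fix the forces performed at the first time step (starting with exactly $B$ blue), choosing for each vertex forced at the first time step one vertex of $B$ that forces it, say $b_1\to v_1,\dots,b_j\to v_j$ with $b_1,\dots,b_j\in B$ distinct, and let $B'=(B\setminus\{b_1,\dots,b_j\})\cup\{v_1,\dots,v_j\}$ (the endpoints of the PSD forcing trees after the first time step). Then $B'$ is a PSD forcing set of $G$ with $|B'|=|B|$. Furthermore, if $\mathrm{pt}_+(G;B)\geq 2$, then $\mathrm{pt}_+(G;B')=\mathrm{pt}_+(G;B)-1$.
   Context: Graphs are finite and simple. PSD color change rule: let $B$ be the current set of blue vertices and let $W_1,\dots,W_r$ be the vertex sets of the components of $G-B$; if $u\in B$, $w\in W_i$, and $w$ is the only white neighbor of $u$ in $G[W_i\cup B]$, then $u$ may force $w$, i.e., color it blue. A set $B$ is a PSD forcing set if starting with exactly $B$ blue, repeated application of the rule colors all of $V(G)$ blue. Given initial blue set $B$, $B^{[0]}=B$ and $B^{[i+1]}$ is $B^{[i]}$ together with all vertices that can be PSD forced when exactly $B^{[i]}$ is blue (the vertices in $B^{[1]}\setminus B$ are those forced at the first time step); $\mathrm{pt}_+(G;B)$ is the least $t$ with $B^{[t]}=V(G)$. -}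

module Defs where

open import Level using (0ℓ)
open import Data.Nat using (ℕ; zero; suc; _<_)
open import Data.Fin using (Fin)
open import Data.Fin.Subset using (Subset; _∈_; _∉_)
open import Data.Product using (Σ; ∃; _×_)
open import Data.Sum using (_⊎_)
open import Relation.Nullary using (¬_; Dec)
open import Relation.Binary.PropositionalEquality using (_≡_)

record Graph (n : ℕ) : Set₁ where
  field
    Adj    : Fin n → Fin n → Set
    adj?   : (x y : Fin n) → Dec (Adj x y)
    sym    : ∀ {x y} → Adj x y → Adj y x
    irrefl : ∀ {x} → ¬ Adj x x

open Graph public

⟦_⟧ : ∀ {n} → Subset n → Fin n → Set
⟦ B ⟧ v = v ∈ B

module _ {n : ℕ} (G : Graph n) where

  VSet : Set₁
  VSet = Fin n → Set

  -- ConnW S x y : x and y lie in the same component of G - S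
  -- (a walk from x to y using only vertices not in S).
  data ConnW (S : VSet) : Fin n → Fin n → Set where
    here : ∀ {x} → ¬ S x → ConnW S x x
    step : ∀ {x y z} → ¬ S x → Adj G x y → ConnW S y z → ConnW S x z

  -- PSD color change rule with current blue set S: u can force w iff
  -- u is blue, w is white, u ~ w, and w is the only white neighbor of u
  -- in G[W ∪ S] where W is the component of G - S containing w.
  CanForce : VSet → Fin n → Fin n → Set
  CanForce S u w =
    S u × ¬ S w × Adj G u w ×
    (∀ x → Adj G u x → ¬ S x → ConnW S w x → x ≡ w)

  Blue : VSet → ℕ → VSet
  Blue S zero    v = S v
  Blue S (suc i) v = Blue S i v ⊎ ∃ λ u → CanForce (Blue S i) u v

  AllBlue : VSet → Set
  AllBlue S = ∀ v → S v

  IsPSDForcingSet : VSet → Set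
  IsPSDForcingSet S = ∃ λ t → AllBlue (Blue S t)

  -- pt₊(G;S) ≡ t, as a relation: t is the least time with S^{[t]} = V(G).
  PropTime : VSet → ℕ → Set
  PropTime S t = AllBlue (Blue S t) × (∀ s → s < t → ¬ AllBlue (Blue S s))

  MinusConnected : Subset n → Set
  MinusConnected B = ∀ x y → x ∉ B → y ∉ B → ConnW ⟦ B ⟧ x y

  FirstForced : Subset n → Fin n → Set
  FirstForced B v = ∃ λ u → CanForce ⟦ B ⟧ u v

-- Since G − B is connected, a vertex b ∈ B forcing v at the first step has v as its only
-- neighbour outside B. Hence, starting from B′, each such v forces b back at once, and every
-- other force of the second step of B is still valid (a walk avoiding B′ that starts outside
-- B^[1] also avoids B^[1]). So B′ ⊆ B^[1] and B^[2] ⊆ B′^[1], and since PSD forcing is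
-- monotone the two processes stay exactly one step apart. The sizes agree because b ↦ v is a
-- bijection between B ∖ B′ and B′ ∖ B.
module Submission where

open import Defs hiding (sym)
open import Data.Nat using (ℕ; zero; suc; _+_; _≤_; _<_; _∸_; z≤n; s≤s)
open import Data.Nat.Properties using (≤-antisym; ≤-trans; +-suc; +-identityʳ; +-monoʳ-≤; m≤m+n; suc-injective; <⇒≱)
open import Data.Fin using (Fin; _≟_)
open import Data.Fin.Properties using (any?; all?)
open import Data.Fin.Subset using (Subset; _∈_; _∉_; ∣_∣; ⊥; ⁅_⁆; _-_; inside; outside; Nonempty)
  renaming (_∪_ to _∪ˢ_)
open import Data.Fin.Subset.Properties
  using (_∈?_; x∈⁅x⁆; x∈⁅y⁆⇒x≡y; x∈p∪q⁺; x∈p∪q⁻; p⊆p∪q; p⊂q⇒∣p∣<∣q∣; ∣p∣≤n; ∉⊥;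
         p─⊥≡p; p─q⊆p; x∈p∧x≢y⇒x∈p-y)
open import Data.Vec using (_∷_; here; there)
open import Data.Product using (∃; _×_; _,_; proj₁)
open import Data.Sum using (_⊎_; inj₁; inj₂; [_,_]; map₂)
open import Data.Empty using (⊥-elim)
open import Function using (_∘_; id)
open import Function.Bundles using (_⇔_; Equivalence)
open import Relation.Nullary using (¬_; Dec; yes; no; contradiction)
open import Relation.Nullary.Decidable using (_×-dec_; _⊎-dec_; _→-dec_; ¬?; map′)
open import Relation.Unary using (Decidable; _⊆_) renaming (_∪_ to _∪ᵖ_)
open import Relation.Binary.PropositionalEquality using (_≡_; _≢_; refl; sym; trans; cong; subst)

∣p∣≡1+∣p-x∣ : ∀ {n} {x : Fin n} {p : Subset n} → x ∈ p → ∣ p ∣ ≡ suc ∣ p - x ∣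
∣p∣≡1+∣p-x∣ {x = Fin.zero} {p = inside ∷ p} here = cong (suc ∘ ∣_∣) (sym (p─⊥≡p p))
∣p∣≡1+∣p-x∣ {x = Fin.suc x} {p = inside ∷ p} (there x∈p) = cong suc (∣p∣≡1+∣p-x∣ x∈p)
∣p∣≡1+∣p-x∣ {x = Fin.suc x} {p = outside ∷ p} (there x∈p) = ∣p∣≡1+∣p-x∣ x∈p

x∈p-y⇒x≢y : ∀ {n} {x y : Fin n} {p : Subset n} → x ∈ p - y → x ≢ y
x∈p-y⇒x≢y {x = Fin.zero} {Fin.suc y} {_ ∷ p} here ()
x∈p-y⇒x≢y {x = Fin.suc x} {Fin.zero} {_ ∷ p} (there _) ()
x∈p-y⇒x≢y {x = Fin.suc x} {Fin.suc y} {_ ∷ p} (there x∈p-y) refl = x∈p-y⇒x≢y x∈p-y refl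

∣p∣≡suc⇒nonempty : ∀ {n k} (p : Subset n) → ∣ p ∣ ≡ suc k → Nonempty p
∣p∣≡suc⇒nonempty (inside ∷ p) _ = Fin.zero , here
∣p∣≡suc⇒nonempty (outside ∷ p) ∣p∣≡1+k with x , x∈p ← ∣p∣≡suc⇒nonempty p ∣p∣≡1+k =
  Fin.suc x , there x∈p

injection⇒∣p∣≤∣q∣ : ∀ {n} {p q : Subset n} (f : Fin n → Fin n)
  → (∀ {x} → x ∈ p → f x ∈ q)
  → (∀ {x y} → x ∈ p → y ∈ p → f x ≡ f y → x ≡ y)
  → ∣ p ∣ ≤ ∣ q ∣
injection⇒∣p∣≤∣q∣ {p = p} f = go ∣ p ∣ refl
  where
  go : ∀ k {p q} → ∣ p ∣ ≡ k
     → (∀ {x} → x ∈ p → f x ∈ q)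
     → (∀ {x y} → x ∈ p → y ∈ p → f x ≡ f y → x ≡ y)
     → k ≤ ∣ q ∣
  go zero _ _ _ = z≤n
  go (suc k) {p} {q} ∣p∣≡1+k maps inj with x , x∈p ← ∣p∣≡suc⇒nonempty p ∣p∣≡1+k =
    subst (suc k ≤_) (sym (∣p∣≡1+∣p-x∣ (maps x∈p)))
      (s≤s (go k (suc-injective (trans (sym (∣p∣≡1+∣p-x∣ x∈p)) ∣p∣≡1+k)) maps′ inj′))
    where
    ⊆p : ∀ {y} → y ∈ p - x → y ∈ p
    ⊆p = p─q⊆p p ⁅ x ⁆
    maps′ : ∀ {y} → y ∈ p - x → f y ∈ q - f x
    maps′ y∈p-x = x∈p∧x≢y⇒x∈p-y (maps (⊆p y∈p-x)) (x∈p-y⇒x≢y y∈p-x ∘ inj (⊆p y∈p-x) x∈p)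
    inj′ : ∀ {y z} → y ∈ p - x → z ∈ p - x → f y ≡ f z → y ≡ z
    inj′ y∈ z∈ = inj (⊆p y∈) (⊆p z∈)

module Walks {n : ℕ} (G : Graph n) where

  ConnW-start : ∀ {S a b} → ConnW G S a b → ¬ S a
  ConnW-start (here ¬Sa) = ¬Sa
  ConnW-start (step ¬Sa _ _) = ¬Sa

  ConnW-end : ∀ {S a b} → ConnW G S a b → ¬ S b
  ConnW-end (here ¬Sb) = ¬Sb
  ConnW-end (step _ _ walk) = ConnW-end walk

  ConnW-antimono : ∀ {S T : Fin n → Set} {a b} → T ⊆ S → ConnW G S a b → ConnW G T a b
  ConnW-antimono T⊆S (here ¬Sa) = here (¬Sa ∘ T⊆S)
  ConnW-antimono T⊆S (step ¬Sa a~b walk) = step (¬Sa ∘ T⊆S) a~b (ConnW-antimono T⊆S walk)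

  -- The exit from x is taken at the last visit of the walk to x.
  ConnW-split : ∀ {S T : Fin n → Set} {x a y} → (∀ {v} → T v → S v ⊎ v ≡ x) → x ≢ y
    → ConnW G S a y → ConnW G T a y ⊎ ∃ λ z → Adj G x z × ConnW G T z y
  ConnW-split T⊆S∪x x≢y (here ¬Sy) = inj₁ (here ([ ¬Sy , x≢y ∘ sym ] ∘ T⊆S∪x))
  ConnW-split {x = x} T⊆S∪x x≢y (step {a} {b} ¬Sa a~b walk)
    with ConnW-split T⊆S∪x x≢y walk | a ≟ x
  ... | inj₂ exit | _ = inj₂ exit
  ... | inj₁ walk′ | yes refl = inj₂ (b , a~b , walk′)
  ... | inj₁ walk′ | no a≢x = inj₁ (step ([ ¬Sa , a≢x ] ∘ T⊆S∪x) a~b walk′)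

  -- Depth-first search: V is the set of visited vertices, and the fuel bounds how often
  -- it can still grow.
  ConnW?-visited : ∀ {S} → Decidable S → (fuel : ℕ) (V : Subset n) → n ≤ fuel + ∣ V ∣
    → ∀ x y → Dec (ConnW G (S ∪ᵖ ⟦ V ⟧) x y)
  ConnW?-visited {S} S? fuel V bound x y with S? x ⊎-dec x ∈? V
  ... | yes blocked = no (contradiction blocked ∘ ConnW-start)
  ... | no free with x ≟ y
  ...   | yes refl = yes (here free)
  ...   | no x≢y = explore fuel bound
    where
    V′ : Subset n
    V′ = V ∪ˢ ⁅ x ⁆
    x∈V′ : x ∈ V′
    x∈V′ = x∈p∪q⁺ (inj₂ (x∈⁅x⁆ x))
    grows : ∣ V ∣ < ∣ V′ ∣
    grows = p⊂q⇒∣p∣<∣q∣ (p⊆p∪q ⁅ x ⁆ , x , x∈V′ , free ∘ inj₂)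
    split : ∀ {v} → (S ∪ᵖ ⟦ V′ ⟧) v → (S ∪ᵖ ⟦ V ⟧) v ⊎ v ≡ x
    split (inj₁ Sv) = inj₁ (inj₁ Sv)
    split (inj₂ v∈V′) = [ inj₁ ∘ inj₂ , inj₂ ∘ x∈⁅y⁆⇒x≡y x ] (x∈p∪q⁻ V ⁅ x ⁆ v∈V′)
    enter : (∃ λ z → Adj G x z × ConnW G (S ∪ᵖ ⟦ V′ ⟧) z y) → ConnW G (S ∪ᵖ ⟦ V ⟧) x y
    enter (z , x~z , walk) = step free x~z (ConnW-antimono (map₂ (p⊆p∪q ⁅ x ⁆)) walk)
    leave : ConnW G (S ∪ᵖ ⟦ V ⟧) x y → ∃ λ z → Adj G x z × ConnW G (S ∪ᵖ ⟦ V′ ⟧) z y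
    leave walk = [ (λ walk′ → contradiction (inj₂ x∈V′) (ConnW-start walk′)) , id ]
                   (ConnW-split split x≢y walk)
    explore : (fuel : ℕ) → n ≤ fuel + ∣ V ∣ → Dec (ConnW G (S ∪ᵖ ⟦ V ⟧) x y)
    explore zero bound = ⊥-elim (<⇒≱ grows (≤-trans (∣p∣≤n V′) bound))
    explore (suc fuel) bound = map′ enter leave
      (any? λ z → adj? G x z ×-dec ConnW?-visited S? fuel V′ bound′ z y)
      where
      bound′ : n ≤ fuel + ∣ V′ ∣
      bound′ = ≤-trans bound (subst (_≤ fuel + ∣ V′ ∣) (+-suc fuel ∣ V ∣) (+-monoʳ-≤ fuel grows))

  ConnW? : ∀ {S} → Decidable S → ∀ x y → Dec (ConnW G S x y)
  ConnW? S? x y = map′ (ConnW-antimono inj₁) (ConnW-antimono [ id , ⊥-elim ∘ ∉⊥ ])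
    (ConnW?-visited S? n ⊥ (m≤m+n n _) x y)

  CanForce? : ∀ {S} → Decidable S → ∀ u w → Dec (CanForce G S u w)
  CanForce? S? u w = S? u ×-dec ¬? (S? w) ×-dec adj? G u w ×-dec
    all? (λ x → adj? G u x →-dec ¬? (S? x) →-dec ConnW? S? w x →-dec x ≟ w)

  Blue? : ∀ {S} → Decidable S → ∀ i → Decidable (Blue G S i)
  Blue? S? zero = S?
  Blue? S? (suc i) v = Blue? S? i v ⊎-dec any? (λ u → CanForce? (Blue? S? i) u v)

  CanForce-mono : ∀ {S T : Fin n → Set} {u w} → S ⊆ T → ¬ T w → CanForce G S u w → CanForce G T u w
  CanForce-mono S⊆T ¬Tw (Su , _ , u~w , unique) =
    S⊆T Su , ¬Tw , u~w , λ x u~x ¬Tx walk → unique x u~x (¬Tx ∘ S⊆T) (ConnW-antimono S⊆T walk)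

  Blue-suc-mono : ∀ {S T i j} → Decidable (Blue G T j)
    → Blue G S i ⊆ Blue G T j → Blue G S (suc i) ⊆ Blue G T (suc j)
  Blue-suc-mono _ S⊆T (inj₁ Sv) = inj₁ (S⊆T Sv)
  Blue-suc-mono T? S⊆T (inj₂ (u , u→v)) with T? _
  ... | yes Tv = inj₁ Tv
  ... | no ¬Tv = inj₂ (u , CanForce-mono S⊆T ¬Tv u→v)

  Blue-mono-+ : ∀ {S T} → Decidable T → ∀ {i j} → Blue G S i ⊆ Blue G T j
    → ∀ k → Blue G S (i + k) ⊆ Blue G T (j + k)
  Blue-mono-+ T? {i} {j} S⊆T zero rewrite +-identityʳ i | +-identityʳ j = S⊆T
  Blue-mono-+ {S} {T} T? {i} {j} S⊆T (suc k) rewrite +-suc i k | +-suc j k =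
    Blue-suc-mono {S} {T} {i + k} {j + k} (Blue? T? (j + k)) (Blue-mono-+ {S} {T} T? {i} {j} S⊆T k)

module FirstTimeStep {n : ℕ} (G : Graph n) (B : Subset n)
  (G-B-connected : MinusConnected G B)
  (forcer : Fin n → Fin n)
  (forcer-forces : ∀ v → FirstForced G B v → CanForce G ⟦ B ⟧ (forcer v) v)
  (B′ : Subset n)
  (B′-spec : ∀ x → (x ∈ B′) ⇔ ((x ∈ B × ¬ (∃ λ v → FirstForced G B v × forcer v ≡ x)) ⊎ FirstForced G B x))
  where

  open Walks G
  open Equivalence

  Forced : Fin n → Set
  Forced = FirstForced G B

  ChosenForcer : Fin n → Set
  ChosenForcer x = ∃ λ v → Forced v × forcer v ≡ x

  Forced? : Decidable Forced
  Forced? v = any? λ u → CanForce? (_∈? B) u v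

  ChosenForcer? : Decidable ChosenForcer
  ChosenForcer? x = any? λ v → Forced? v ×-dec forcer v ≟ x

  forced∉B : ∀ {v} → Forced v → v ∉ B
  forced∉B (_ , _ , v∉B , _) = v∉B

  chosen∈B : ∀ {x} → ChosenForcer x → x ∈ B
  chosen∈B (v , fv , refl) = proj₁ (forcer-forces v fv)

  forcer-adj : ∀ {v} → Forced v → Adj G (forcer v) v
  forcer-adj fv with _ , _ , forcer~v , _ ← forcer-forces _ fv = forcer~v

  -- As G − B is connected, the component of the forced vertex is all of G − B.
  forcer-white-neighbour : ∀ {v x} → Forced v → Adj G (forcer v) x → x ∉ B → x ≡ v
  forcer-white-neighbour {v} fv forcer~x x∉B with _ , v∉B , _ , unique ← forcer-forces v fv =
    unique _ forcer~x x∉B (G-B-connected _ _ v∉B x∉B)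

  chosen-white-neighbour-forced : ∀ {u x} → ChosenForcer u → Adj G u x → x ∉ B → Forced x
  chosen-white-neighbour-forced (v , fv , refl) u~x x∉B =
    subst Forced (sym (forcer-white-neighbour fv u~x x∉B)) fv

  kept∈B′ : ∀ {x} → x ∈ B → ¬ ChosenForcer x → x ∈ B′
  kept∈B′ x∈B ¬chosen = from (B′-spec _) (inj₁ (x∈B , ¬chosen))

  forced∈B′ : ∀ {x} → Forced x → x ∈ B′
  forced∈B′ fx = from (B′-spec _) (inj₂ fx)

  chosen∉B′ : ∀ {x} → ChosenForcer x → x ∉ B′
  chosen∉B′ chosen x∈B′ with to (B′-spec _) x∈B′
  ... | inj₁ (_ , ¬chosen) = ¬chosen chosen
  ... | inj₂ fx = forced∉B fx (chosen∈B chosen)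

  B∖B′⊆chosen : ∀ {x} → x ∈ B → x ∉ B′ → ChosenForcer x
  B∖B′⊆chosen {x} x∈B x∉B′ with ChosenForcer? x
  ... | yes chosen = chosen
  ... | no ¬chosen = contradiction (kept∈B′ x∈B ¬chosen) x∉B′

  B′⊆B¹ : ⟦ B′ ⟧ ⊆ Blue G ⟦ B ⟧ 1
  B′⊆B¹ x∈B′ = [ inj₁ ∘ proj₁ , inj₂ ] (to (B′-spec _) x∈B′)

  walk-avoiding-B′-from-B-stays-in-B : ∀ {a x} → a ∈ B → ConnW G ⟦ B′ ⟧ a x → x ∈ B
  walk-avoiding-B′-from-B-stays-in-B a∈B (here _) = a∈B
  walk-avoiding-B′-from-B-stays-in-B a∈B (step {y = z} a∉B′ a~z walk) =
    walk-avoiding-B′-from-B-stays-in-B z∈B walk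
    where
    z∈B : z ∈ B
    z∈B with z ∈? B
    ... | yes z∈B = z∈B
    ... | no z∉B = contradiction
      (forced∈B′ (chosen-white-neighbour-forced (B∖B′⊆chosen a∈B a∉B′) a~z z∉B)) (ConnW-start walk)

  walk-avoiding-B′-from-outside-B¹-avoids-B¹ : ∀ {y x} → ¬ Blue G ⟦ B ⟧ 1 y
    → ConnW G ⟦ B′ ⟧ y x → ConnW G (Blue G ⟦ B ⟧ 1) y x
  walk-avoiding-B′-from-outside-B¹-avoids-B¹ y∉B¹ (here _) = here y∉B¹
  walk-avoiding-B′-from-outside-B¹-avoids-B¹ y∉B¹ (step {y = z} _ y~z walk) =
    step y∉B¹ y~z (walk-avoiding-B′-from-outside-B¹-avoids-B¹ z∉B¹ walk)
    where
    z∉B¹ : ¬ Blue G ⟦ B ⟧ 1 z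
    z∉B¹ (inj₂ fz) = ConnW-start walk (forced∈B′ fz)
    z∉B¹ (inj₁ z∈B) = y∉B¹ (inj₂ (chosen-white-neighbour-forced
      (B∖B′⊆chosen z∈B (ConnW-start walk)) (Graph.sym G y~z) (y∉B¹ ∘ inj₁)))

  forced-forces-its-forcer : ∀ {w} → Forced w → CanForce G ⟦ B′ ⟧ w (forcer w)
  forced-forces-its-forcer {w} fw =
    forced∈B′ fw , chosen∉B′ (w , fw , refl) , Graph.sym G (forcer-adj fw) , unique
    where
    unique : ∀ x → Adj G w x → x ∉ B′ → ConnW G ⟦ B′ ⟧ (forcer w) x → x ≡ forcer w
    unique x w~x x∉B′ walk
      with v , fv , refl ←
        B∖B′⊆chosen (walk-avoiding-B′-from-B-stays-in-B (chosen∈B (w , fw , refl)) walk) x∉B′ =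
      cong forcer (sym (forcer-white-neighbour fv (Graph.sym G w~x) (forced∉B fw)))

  B¹-forcer∈B′ : ∀ {u v} → Blue G ⟦ B ⟧ 1 u → Adj G u v → ¬ Blue G ⟦ B ⟧ 1 v → u ∈ B′
  B¹-forcer∈B′ (inj₂ fu) _ _ = forced∈B′ fu
  B¹-forcer∈B′ {u} (inj₁ u∈B) u~v v∉B¹ with u ∈? B′
  ... | yes u∈B′ = u∈B′
  ... | no u∉B′ = contradiction
    (inj₂ (chosen-white-neighbour-forced (B∖B′⊆chosen u∈B u∉B′) u~v (v∉B¹ ∘ inj₁))) v∉B¹

  B²⊆B′¹ : Blue G ⟦ B ⟧ 2 ⊆ Blue G ⟦ B′ ⟧ 1
  B²⊆B′¹ {v} (inj₁ (inj₁ v∈B)) with ChosenForcer? v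
  ... | yes (w , fw , refl) = inj₂ (w , forced-forces-its-forcer fw)
  ... | no ¬chosen = inj₁ (kept∈B′ v∈B ¬chosen)
  B²⊆B′¹ (inj₁ (inj₂ fv)) = inj₁ (forced∈B′ fv)
  B²⊆B′¹ {v} (inj₂ (u , u∈B¹ , v∉B¹ , u~v , unique)) =
    inj₂ (u , B¹-forcer∈B′ u∈B¹ u~v v∉B¹ , v∉B¹ ∘ B′⊆B¹ , u~v , unique′)
    where
    unique′ : ∀ x → Adj G u x → x ∉ B′ → ConnW G ⟦ B′ ⟧ v x → x ≡ v
    unique′ x u~x _ walk = unique x u~x (ConnW-end walk′) walk′
      where
      walk′ : ConnW G (Blue G ⟦ B ⟧ 1) v x
      walk′ = walk-avoiding-B′-from-outside-B¹-avoids-B¹ v∉B¹ walk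

  forced↦forcer : Fin n → Fin n
  forced↦forcer x with Forced? x
  ... | yes _ = forcer x
  ... | no _ = x

  ∣B′∣≤∣B∣ : ∣ B′ ∣ ≤ ∣ B ∣
  ∣B′∣≤∣B∣ = injection⇒∣p∣≤∣q∣ forced↦forcer maps injective
    where
    maps : ∀ {x} → x ∈ B′ → forced↦forcer x ∈ B
    maps {x} x∈B′ with Forced? x | to (B′-spec x) x∈B′
    ... | yes fx | _ = chosen∈B (x , fx , refl)
    ... | no _ | inj₁ (x∈B , _) = x∈B
    ... | no ¬fx | inj₂ fx = contradiction fx ¬fx
    injective : ∀ {x y} → x ∈ B′ → y ∈ B′ → forced↦forcer x ≡ forced↦forcer y → x ≡ y
    injective {x} {y} x∈B′ y∈B′ eq with Forced? x | Forced? y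
    ... | yes fx | yes fy =
      forcer-white-neighbour fy (subst (λ b → Adj G b x) eq (forcer-adj fx)) (forced∉B fx)
    ... | yes fx | no _ = contradiction y∈B′ (chosen∉B′ (x , fx , eq))
    ... | no _ | yes fy = contradiction x∈B′ (chosen∉B′ (y , fy , sym eq))
    ... | no _ | no _ = eq

  chosen↦forced : Fin n → Fin n
  chosen↦forced x with ChosenForcer? x
  ... | yes (v , _) = v
  ... | no _ = x

  ∣B∣≤∣B′∣ : ∣ B ∣ ≤ ∣ B′ ∣
  ∣B∣≤∣B′∣ = injection⇒∣p∣≤∣q∣ chosen↦forced maps injective
    where
    maps : ∀ {x} → x ∈ B → chosen↦forced x ∈ B′
    maps {x} x∈B with ChosenForcer? x
    ... | yes (_ , fv , _) = forced∈B′ fv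
    ... | no ¬chosen = kept∈B′ x∈B ¬chosen
    injective : ∀ {x y} → x ∈ B → y ∈ B → chosen↦forced x ≡ chosen↦forced y → x ≡ y
    injective {x} {y} x∈B y∈B eq with ChosenForcer? x | ChosenForcer? y
    ... | yes (_ , _ , refl) | yes (_ , _ , refl) = cong forcer eq
    ... | yes (_ , fv , _) | no _ = contradiction (subst (_∈ B) (sym eq) y∈B) (forced∉B fv)
    ... | no _ | yes (_ , fv , _) = contradiction (subst (_∈ B) eq x∈B) (forced∉B fv)
    ... | no _ | no _ = eq

  B′ˢ⊆B¹⁺ˢ : ∀ s → Blue G ⟦ B′ ⟧ s ⊆ Blue G ⟦ B ⟧ (suc s)
  B′ˢ⊆B¹⁺ˢ = Blue-mono-+ (_∈? B) {0} {1} B′⊆B¹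

  B²⁺ˢ⊆B′¹⁺ˢ : ∀ s → Blue G ⟦ B ⟧ (suc (suc s)) ⊆ Blue G ⟦ B′ ⟧ (suc s)
  B²⁺ˢ⊆B′¹⁺ˢ = Blue-mono-+ (_∈? B′) {2} {1} B²⊆B′¹

lemma3p1 : ∀ {n} (G : Graph n) (B : Subset n)
    → IsPSDForcingSet G ⟦ B ⟧
    → MinusConnected G B
    → (forcer : Fin n → Fin n)
    → (∀ v → FirstForced G B v → CanForce G ⟦ B ⟧ (forcer v) v)
    → (B' : Subset n)
    → (∀ x → (x ∈ B') ⇔ ((x ∈ B × ¬ (∃ λ v → FirstForced G B v × forcer v ≡ x)) ⊎ FirstForced G B x))
    → IsPSDForcingSet G ⟦ B' ⟧
      × ∣ B' ∣ ≡ ∣ B ∣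
      × (∀ t → PropTime G ⟦ B ⟧ t → 2 ≤ t → PropTime G ⟦ B' ⟧ (t ∸ 1))
lemma3p1 G B (t , B-forces) G-B-connected forcer forcer-forces B′ B′-spec =
  (suc t , λ v → B²⁺ˢ⊆B′¹⁺ˢ t (inj₁ (inj₁ (B-forces v)))) ,
  ≤-antisym ∣B′∣≤∣B∣ ∣B∣≤∣B′∣ ,
  propagation-time
  where
  open FirstTimeStep G B G-B-connected forcer forcer-forces B′ B′-spec
  propagation-time : ∀ t → PropTime G ⟦ B ⟧ t → 2 ≤ t → PropTime G ⟦ B′ ⟧ (t ∸ 1)
  propagation-time (suc (suc s)) (B-done , B-not-earlier) (s≤s (s≤s z≤n)) =
    (λ v → B²⁺ˢ⊆B′¹⁺ˢ s (B-done v)) ,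
    λ r r<s B′-done → B-not-earlier (suc r) (s≤s r<s) (λ v → B′ˢ⊆B¹⁺ˢ r (B′-done v))
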